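{- Let $T$ be a filling of the two-row shape $(m,2)$ with $m\ge2$ (lower row $1$ of length $m$, upper row $2$ of length $2$), and write $a=T_{2,1}$, $b=T_{2,2}$, $A=T_{1,1}$. Let $T'$ be the filling obtained from $T$ by exchanging the two entries of row $2$ (so $T'_{2,1}=b$, $T'_{2,2}=a$, row $1$ unchanged). If $a\le A<b$ or $b\le A<a$, then \[ \#\operatorname{Inv}_2(T)=\operatorname{inv}_{2,1}(T'). \]
   Context: Cells are $(i,j)$ with row $i$ counted from the bottom and column $j$ from the left; entries are positive integers. For a cell $u=(i,j)$ in a shape $\lambda$, $\operatorname{arm}(u)=\lambda_i-j$. For a filling $S$ of a shape whose second row has length $\lambda_2$: $\operatorname{Inv}_2(S)=\{(j,k):1\le j<k\le\lambda_2,\ S_{2,j}>S_{2,k}\}$; $\operatorname{Att}_{2,1}=\{((2,k),(1,j)):1\le j<k\le\lambda_2\}$ (upper cell strictly to the right of the lower cell in the row below); $\operatorname{Inv}_{2,1}(S)=\{((2,k),(1,j))\in\operatorname{Att}_{2,1}: S_{2,k}>S_{1,j}\}$; $\operatorname{Des}_{2,1}(S)=\{(2,j): S_{2,j}>S_{1,j}\}$; $\operatorname{arm}_{2,1}(S)=\sum_{u\in\operatorname{Des}_{2,1}(S)}\operatorname{arm}(u)$; and $\operatorname{inv}_{2,1}(S)=\#\operatorname{Inv}_2(S)+\#\operatorname{Inv}_{2,1}(S)-\operatorname{arm}_{2,1}(S)$. -}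

module Defs where

open import Data.Nat using (ℕ; _+_; _∸_; _≤_; _<_; _≤?_; _<?_; s≤s; z≤n)
open import Data.Integer using (ℤ; +_; _-_) renaming (_+_ to _+ℤ_)
open import Data.Fin using (Fin; toℕ; inject≤)
open import Data.List using (List; length; filter; allFin; cartesianProduct; map)
open import Data.Nat.ListAction using (sum)
open import Data.Product using (_×_; _,_; proj₁; proj₂)
open import Data.Fin using (zero; suc)

-- A filling of a two-row shape (λ₁, λ₂) with λ₂ ≤ λ₁.
-- Row 1 (bottom) has cells (1,j), j = 1..λ₁; row 2 has cells (2,j), j = 1..λ₂.
-- Column j (1-based) corresponds to the Fin index j-1.
record Filling (λ₁ λ₂ : ℕ) : Set where
  constructor filling
  field
    row1 : Fin λ₁ → ℕ
    row2 : Fin λ₂ → ℕ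

open Filling public

Positive : ∀ {λ₁ λ₂} → Filling λ₁ λ₂ → Set
Positive S = (∀ j → 1 ≤ row1 S j) × (∀ j → 1 ≤ row2 S j)

pairs< : ∀ n → List (Fin n × Fin n)
pairs< n = filter (λ p → toℕ (proj₁ p) <? toℕ (proj₂ p)) (cartesianProduct (allFin n) (allFin n))

low : ∀ {λ₁ λ₂} → λ₂ ≤ λ₁ → Filling λ₁ λ₂ → Fin λ₂ → ℕ
low le S j = row1 S (inject≤ j le)

Inv₂ : ∀ {λ₁ λ₂} → Filling λ₁ λ₂ → List (Fin λ₂ × Fin λ₂)
Inv₂ {λ₂ = n} S = filter (λ p → row2 S (proj₂ p) <? row2 S (proj₁ p)) (pairs< n)

-- Att₂,₁ = {((2,k),(1,j)) : 1 ≤ j < k ≤ λ₂}, encoded as pairs (j , k)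
Att₂₁ : ∀ n → List (Fin n × Fin n)
Att₂₁ n = pairs< n

Inv₂₁ : ∀ {λ₁ λ₂} → λ₂ ≤ λ₁ → Filling λ₁ λ₂ → List (Fin λ₂ × Fin λ₂)
Inv₂₁ {λ₂ = n} le S = filter (λ p → low le S (proj₁ p) <? row2 S (proj₂ p)) (Att₂₁ n)

Des₂₁ : ∀ {λ₁ λ₂} → λ₂ ≤ λ₁ → Filling λ₁ λ₂ → List (Fin λ₂)
Des₂₁ {λ₂ = n} le S = filter (λ j → low le S j <? row2 S j) (allFin n)

-- arm of cell (2,j) (j 1-based = toℕ j + 1): λ₂ - j
arm₂ : ∀ {λ₂} → Fin λ₂ → ℕ
arm₂ {λ₂} j = λ₂ ∸ (1 + toℕ j)

arm₂₁ : ∀ {λ₁ λ₂} → λ₂ ≤ λ₁ → Filling λ₁ λ₂ → ℕ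
arm₂₁ le S = sum (map arm₂ (Des₂₁ le S))

inv₂₁ : ∀ {λ₁ λ₂} → λ₂ ≤ λ₁ → Filling λ₁ λ₂ → ℤ
inv₂₁ le S = (+ length (Inv₂ S) +ℤ + length (Inv₂₁ le S)) - + arm₂₁ le S

swapRow2 : ∀ {m} → Filling m 2 → Filling m 2
swapRow2 S = filling (row1 S) λ { zero → row2 S (suc zero) ; (suc _) → row2 S zero }

-- For two columns everything is a single comparison: with T' = swapRow2 T,
-- #Inv₂(T) = [b < a], #Inv₂(T') = [a < b], #Inv₂,₁(T') = [A < a], and only
-- column 1 has positive arm, so arm₂,₁(T') = [A < b]. Under either hypothesis
-- the three indicators on the right are (1, 0, 1) or (0, 1, 0).
module Submission where

open import Defs
open import Data.Nat using (ℕ; _≤_; _<_; _<?_; _<ᵇ_)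
open import Data.Nat.Properties using (<-asym; ≤-<-trans; ≤⇒≯)
open import Data.Integer using (+_)
open import Data.Bool using (Bool; true; false)
open import Data.Fin using (zero; suc)
open import Data.List using (length)
open import Data.Sum using (_⊎_; inj₁; inj₂)
open import Data.Product using (_×_; _,_)
open import Relation.Nullary using (¬_; does)
open import Relation.Nullary.Decidable using (dec-true; dec-false)
open import Relation.Binary.PropositionalEquality using (_≡_; refl)

indicator : Bool → ℕ
indicator true  = 1
indicator false = 0

[_<_] : ℕ → ℕ → ℕ
[ x < y ] = indicator (does (x <? y))

[<]≡1 : ∀ {x y} → x < y → [ x < y ] ≡ 1
[<]≡1 {x} {y} x<y rewrite dec-true (x <? y) x<y = refl

[<]≡0 : ∀ {x y} → ¬ x < y → [ x < y ] ≡ 0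
[<]≡0 {x} {y} x≮y rewrite dec-false (x <? y) x≮y = refl

-- does (x <? y) reduces to x <ᵇ y, which is where filter gets stuck, so the
-- case splits below are on _<ᵇ_.
module _ {m : ℕ} (le : 2 ≤ m) (S : Filling m 2) where

  length-Inv₂-two : length (Inv₂ S) ≡ [ row2 S (suc zero) < row2 S zero ]
  length-Inv₂-two with row2 S (suc zero) <ᵇ row2 S zero
  ... | true  = refl
  ... | false = refl

  length-Inv₂₁-two : length (Inv₂₁ le S) ≡ [ low le S zero < row2 S (suc zero) ]
  length-Inv₂₁-two with low le S zero <ᵇ row2 S (suc zero)
  ... | true  = refl
  ... | false = refl

  arm₂₁-two : arm₂₁ le S ≡ [ low le S zero < row2 S zero ]
  arm₂₁-two with low le S zero <ᵇ row2 S zero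
  ... | true  with low le S (suc zero) <ᵇ row2 S (suc zero)
  ...   | true  = refl
  ...   | false = refl
  arm₂₁-two | false with low le S (suc zero) <ᵇ row2 S (suc zero)
  ...   | true  = refl
  ...   | false = refl

lemma1 : (m : ℕ) (le : 2 ≤ m) (T : Filling m 2) → Positive T →
    let a = row2 T zero
        b = row2 T (suc zero)
        A = low le T zero
    in (a ≤ A × A < b) ⊎ (b ≤ A × A < a) →
       + length (Inv₂ T) ≡ inv₂₁ le (swapRow2 T)
lemma1 m le T _ h
  rewrite length-Inv₂-two le T
        | length-Inv₂-two le (swapRow2 T)
        | length-Inv₂₁-two le (swapRow2 T)
        | arm₂₁-two le (swapRow2 T)
  with h
... | inj₁ (a≤A , A<b)
  rewrite [<]≡0 (<-asym (≤-<-trans a≤A A<b)) | [<]≡1 (≤-<-trans a≤A A<b)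
        | [<]≡0 (≤⇒≯ a≤A) | [<]≡1 A<b = refl
... | inj₂ (b≤A , A<a)
  rewrite [<]≡1 (≤-<-trans b≤A A<a) | [<]≡0 (<-asym (≤-<-trans b≤A A<a))
        | [<]≡1 A<a | [<]≡0 (≤⇒≯ b≤A) = refl
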